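{- Let $n\ge1$ and let $c=(c_1,\dots,c_n)$ be a stable configuration on the fan graph $F_n$ (for $n\ge2$ these are exactly the $c\in\{0,1,2\}^n$ with $c_1,c_n\le1$). Then $c$ is recurrent if and only if for all $i,j\in[n]$ with $i<j$ and $c_i=c_j=0$ there exists $k$ with $i<k<j$ and $c_k=2$.
   Context: The fan graph $F_n$ has vertex set $\{0,1,\dots,n\}$, edges $\{i,i+1\}$ for $i\in[n-1]$, and edges $\{0,i\}$ for all $i\in[n]$; $0$ is the sink. Abelian sandpile model: a configuration is $c\in\mathbb{Z}_{\ge0}^n$, stable if $c_i<\deg(i)$ for all $i\in[n]$. Toppling an unstable $i$ removes $\deg(i)$ grains from $i$ and gives one to each neighbour (grains sent to $0$ are lost); repeated toppling gives a unique stabilisation. With a distribution $\mu$ on $[n]$, all $\mu_i>0$, the Markov chain on stable configurations adds a grain at $i$ with probability $\mu_i$ and stabilises; recurrent configurations are its recurrent states. (On $F_n$ the stochastic variant of the model has the same recurrent configurations.) -}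

module Defs where

open import Data.Nat using (ℕ; zero; suc; _+_; _∸_; _<_; _≤_; _<ᵇ_)
open import Data.Bool using (Bool; true; false; if_then_else_)
open import Data.Fin using (Fin; toℕ)
import Data.Fin as Fin
open import Data.Vec using (Vec; lookup; tabulate; updateAt)
open import Data.Product using (Σ; ∃; _×_)
open import Relation.Nullary using (Dec; yes; no; does)
open import Relation.Binary.PropositionalEquality using (_≡_)
open import Relation.Binary.Construct.Closure.ReflexiveTransitive using (Star)
import Data.Nat.Properties as ℕP

-- Fan graph F_n: sink 0, non-sink vertices 1..n represented by k : Fin n
-- (k stands for vertex toℕ k + 1).  Edges {i,i+1} (path) and {0,i}.

Config : ℕ → Set
Config n = Vec ℕ n

adjᵇ : ∀ {n} → Fin n → Fin n → Bool
adjᵇ i j = does (suc (toℕ i) ℕP.≟ toℕ j) Data.Bool.∨ does (suc (toℕ j) ℕP.≟ toℕ i)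
  where import Data.Bool

-- degree of non-sink vertex k in F_n: 1 (edge to sink) + number of path neighbours
deg : ∀ {n} → Fin n → ℕ
deg {n} k = 1 + (if 0 <ᵇ toℕ k then 1 else 0) + (if suc (toℕ k) <ᵇ n then 1 else 0)

Stable : ∀ {n} → Config n → Set
Stable {n} c = (k : Fin n) → lookup c k < deg k

Unstable : ∀ {n} → Fin n → Config n → Set
Unstable k c = deg k ≤ lookup c k

-- toppling vertex k: k loses deg k grains, each path neighbour gains one
-- (the grain sent to the sink is lost)
topple : ∀ {n} → Fin n → Config n → Config n
topple k c = tabulate λ j →
  if does (j Fin.≟ k) then lookup c j ∸ deg k
  else (if adjᵇ j k then suc (lookup c j) else lookup c j)

Topple : ∀ {n} → Config n → Config n → Set
Topple {n} c c' = Σ (Fin n) λ k → Unstable k c × c' ≡ topple k c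

Stabilises : ∀ {n} → Config n → Config n → Set
Stabilises c d = Star Topple c d × Stable d

addGrain : ∀ {n} → Fin n → Config n → Config n
addGrain k c = updateAt c k suc

-- transitions of the Markov chain with positive probability
-- (every μ_k > 0, so a grain may be added at any vertex)
Step : ∀ {n} → Config n → Config n → Set
Step {n} c d = Σ (Fin n) λ k → Stabilises (addGrain k c) d

Reach : ∀ {n} → Config n → Config n → Set
Reach = Star Step

-- recurrent state of the finite Markov chain: every state reachable from c
-- leads back to c
Recurrent : ∀ {n} → Config n → Set
Recurrent c = Stable c × (∀ d → Reach c d → Reach d c)

ZerosSeparated : ∀ {n} → Config n → Set
ZerosSeparated {n} c =
  (i j : Fin n) → i Fin.< j → lookup c i ≡ 0 → lookup c j ≡ 0 →
  ∃ λ (k : Fin n) → (i Fin.< k) × (k Fin.< j) × (lookup c k ≡ 2)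

{-# OPTIONS --safe #-}
-- Write cmax for the maximal stable configuration and call an interval [a, b] of the path
-- forbidden for c if each of its vertices holds fewer grains than it has neighbours inside
-- [a, b] (Dhar's forbidden subconfigurations, restricted to intervals).  Adding grains one at
-- a time leads from every stable configuration to cmax, so c is recurrent iff cmax reaches c.
--
-- (⇒) cmax has no forbidden interval.  Adding grains cannot create one, and neither can
-- toppling a vertex v: removing v from an interval that is forbidden afterwards leaves a piece
-- that was forbidden before.  A stable configuration without forbidden intervals has a 2
-- between any two zeros.
--
-- (⇐) Adding a grain at p to a configuration that is maximal on [p, q] topples p, p + 1, …, q
-- in turn, leaving 1, …, 1, 0 on [p, q] and one extra grain on p - 1 and q + 1.  Running such
-- a wave backwards at the leftmost zero q of c, with [p, q) the maximal block of 1s before it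
-- (so c has a 2 at p - 1), gives a predecessor of c whose zeros are still separated and all lie
-- right of q.  This reduces c to a configuration without zeros, which lies above the
-- configuration 1, …, 1, 0 obtained from cmax by the wave with p = 0 and q = n - 1.
module Submission where

open import Defs
open import Data.Nat
  using (ℕ; zero; suc; pred; _+_; _∸_; _<_; _≤_; _<ᵇ_; z≤n; s≤s; s≤s⁻¹; s<s⁻¹; ≢-nonZero)
open import Data.Nat.Properties
open import Data.Nat.Induction using (<-wellFounded)
open import Induction.WellFounded using (Acc; acc)
open import Data.Bool using (true; false; if_then_else_)
open import Data.Fin using (Fin; toℕ; fromℕ<)
import Data.Fin as Fin
open import Data.Fin.Properties using (toℕ-injective; toℕ<n; toℕ-fromℕ<; any?)
open import Data.Vec using (Vec; _∷_; lookup; tabulate; zipWith; sum)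
open import Data.Vec.Properties
  using (lookup∘tabulate; tabulate∘lookup; tabulate-cong; lookup∘updateAt; lookup∘updateAt′)
open import Data.Product using (∃; _×_; _,_)
open import Data.Sum using (_⊎_; inj₁; inj₂)
open import Data.Empty using (⊥-elim)
open import Function using (_∘_; id; case_of_)
open import Function.Bundles using (_⇔_; mk⇔)
open import Relation.Nullary using (yes; no; does; ¬_; _×-dec_)
open import Relation.Nullary.Decidable using (dec-true; dec-false)
open import Relation.Binary.Core using (Rel)
open import Relation.Binary.Definitions using (_Respects_; tri<; tri≈; tri>)
open import Relation.Binary.PropositionalEquality
open import Relation.Binary.Construct.Closure.ReflexiveTransitive using (Star; ε; _◅_; _◅◅_; fold)

Star-respects : ∀ {a t p} {A : Set a} {T : Rel A t} {P : A → Set p} →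
                P Respects T → P Respects Star T
Star-respects {P = P} resp = fold (λ x y → P x → P y) (λ step rest → rest ∘ resp step) id

𝟙[_<_] : ℕ → ℕ → ℕ
𝟙[ a < b ] = if a <ᵇ b then 1 else 0

𝟙-holds : ∀ {a b} → a < b → 𝟙[ a < b ] ≡ 1
𝟙-holds {zero}  {suc b} _       = refl
𝟙-holds {suc a} {suc b} (s≤s p) = 𝟙-holds p

𝟙-fails : ∀ {a b} → b ≤ a → 𝟙[ a < b ] ≡ 0
𝟙-fails {a}     {zero}  _       = refl
𝟙-fails {suc a} {suc b} (s≤s p) = 𝟙-fails p

𝟙≤1 : ∀ a b → 𝟙[ a < b ] ≤ 1
𝟙≤1 a b with a <? b
... | yes a<b = ≤-reflexive (𝟙-holds a<b)
... | no  a≮b = ≤-trans (≤-reflexive (𝟙-fails (≮⇒≥ a≮b))) z≤n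

𝟙-mono : ∀ {i b n} → b < n → 𝟙[ i < b ] ≤ 𝟙[ suc i < n ]
𝟙-mono {i} {b} b<n with i <? b
... | yes i<b = ≤-reflexive (trans (𝟙-holds i<b) (sym (𝟙-holds (≤-<-trans i<b b<n))))
... | no  i≮b = ≤-trans (≤-reflexive (𝟙-fails (≮⇒≥ i≮b))) z≤n

one-or-two : ∀ {m} → m ≤ 2 → m ≢ 0 → m ≡ 1 ⊎ m ≡ 2
one-or-two {zero}              _              m≢0 = ⊥-elim (m≢0 refl)
one-or-two {suc zero}          _              _   = inj₁ refl
one-or-two {suc (suc zero)}    _              _   = inj₂ refl
one-or-two {suc (suc (suc _))} (s≤s (s≤s ())) _

suc-pred-≢0 : ∀ {m} → m ≢ 0 → suc (pred m) ≡ m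
suc-pred-≢0 m≢0 = suc-pred _ ⦃ ≢-nonZero m≢0 ⦄

deficit : ∀ {n} → Vec ℕ n → Vec ℕ n → ℕ
deficit t d = sum (zipWith _∸_ t d)

deficit-addGrain : ∀ {n} (t d : Vec ℕ n) k → lookup d k < lookup t k →
                   deficit t (addGrain k d) < deficit t d
deficit-addGrain (a ∷ t) (b ∷ d) Fin.zero    b<a =
  +-monoˡ-< (deficit t d) (∸-monoʳ-< (n<1+n b) b<a)
deficit-addGrain (a ∷ t) (b ∷ d) (Fin.suc k) lt  =
  +-monoʳ-< (a ∸ b) (deficit-addGrain t d k lt)

module _ {n : ℕ} where

  -- deg k ≡ suc (pathDeg k) holds by definition.
  pathDeg : Fin n → ℕ
  pathDeg k = 𝟙[ 0 < toℕ k ] + 𝟙[ suc (toℕ k) < n ]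

  pathDeg≤2 : ∀ k → pathDeg k ≤ 2
  pathDeg≤2 k = +-mono-≤ (𝟙≤1 0 (toℕ k)) (𝟙≤1 (suc (toℕ k)) n)

  pathDeg-positive : 2 ≤ n → ∀ k → 1 ≤ pathDeg k
  pathDeg-positive 2≤n k with 0 <? toℕ k
  ... | yes 0<k = ≤-trans (≤-reflexive (sym (𝟙-holds 0<k))) (m≤m+n _ _)
  ... | no  0≮k = ≤-trans (≤-reflexive (sym (𝟙-holds 1+k<n))) (m≤n+m _ _)
    where
      1+k<n : suc (toℕ k) < n
      1+k<n = subst (λ m → suc m < n) (sym (n≤0⇒n≡0 (≮⇒≥ 0≮k))) 2≤n

  pathDeg-zero : n ≤ 1 → ∀ k → pathDeg k ≡ 0
  pathDeg-zero n≤1 k =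
    cong₂ _+_ (𝟙-fails (s≤s⁻¹ (≤-trans (toℕ<n k) n≤1))) (𝟙-fails (≤-trans n≤1 (s≤s z≤n)))

  cmax : Config n
  cmax = tabulate pathDeg

  infix 4 _≤ᶜ_
  record _≤ᶜ_ (c d : Config n) : Set where
    constructor pointwise
    field lookup-≤ : ∀ i → lookup c i ≤ lookup d i
  open _≤ᶜ_

  config-ext : {c d : Config n} → (∀ i → lookup c i ≡ lookup d i) → c ≡ d
  config-ext {c} {d} c≗d =
    trans (sym (tabulate∘lookup c)) (trans (tabulate-cong c≗d) (tabulate∘lookup d))

  ≤ᶜ-stable : {c d : Config n} → c ≤ᶜ d → Stable d → Stable c
  ≤ᶜ-stable c≤d d-stable i = ≤-<-trans (lookup-≤ c≤d i) (d-stable i)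

  cmax-stable : Stable cmax
  cmax-stable i = s≤s (≤-reflexive (lookup∘tabulate pathDeg i))

  stable⇒≤ᶜcmax : {c : Config n} → Stable c → c ≤ᶜ cmax
  stable⇒≤ᶜcmax c-stable =
    pointwise λ i → ≤-trans (s≤s⁻¹ (c-stable i)) (≤-reflexive (sym (lookup∘tabulate pathDeg i)))

  stable⇒≤2 : {c : Config n} → Stable c → ∀ i → lookup c i ≤ 2
  stable⇒≤2 c-stable i = ≤-trans (s≤s⁻¹ (c-stable i)) (pathDeg≤2 i)

  stable⇒cmax : n ≤ 1 → {c : Config n} → Stable c → c ≡ cmax
  stable⇒cmax n≤1 {c} c-stable = config-ext λ i →
    let cmax-i≡0 = trans (lookup∘tabulate pathDeg i) (pathDeg-zero n≤1 i)
        ci≤0 = ≤-trans (lookup-≤ (stable⇒≤ᶜcmax {c} c-stable) i) (≤-reflexive cmax-i≡0)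
    in trans (n≤0⇒n≡0 ci≤0) (sym cmax-i≡0)

  lookup-topple : ∀ k (c : Config n) j → lookup (topple k c) j ≡
    (if does (j Fin.≟ k) then lookup c j ∸ deg k
     else (if adjᵇ j k then suc (lookup c j) else lookup c j))
  lookup-topple k c j = lookup∘tabulate _ j

  topple-self : ∀ k (c : Config n) → lookup (topple k c) k ≡ lookup c k ∸ deg k
  topple-self k c rewrite lookup-topple k c k | dec-true (k Fin.≟ k) refl = refl

  topple-full : ∀ k (c : Config n) → lookup c k ≡ deg k → lookup (topple k c) k ≡ 0
  topple-full k c ck≡deg = trans (topple-self k c) (trans (cong (_∸ deg k) ck≡deg) (n∸n≡0 (deg k)))

  topple-left : ∀ k (c : Config n) j → suc (toℕ j) ≡ toℕ k →
                lookup (topple k c) j ≡ suc (lookup c j)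
  topple-left k c j e
    rewrite lookup-topple k c j | dec-false (j Fin.≟ k) (λ { refl → 1+n≢n e })
          | dec-true (suc (toℕ j) ≟ toℕ k) e = refl

  topple-right : ∀ k (c : Config n) j → toℕ j ≡ suc (toℕ k) →
                 lookup (topple k c) j ≡ suc (lookup c j)
  topple-right k c j e
    rewrite lookup-topple k c j | dec-false (j Fin.≟ k) (λ { refl → 1+n≢n (sym e) })
          | dec-false (suc (toℕ j) ≟ toℕ k) (>⇒≢ (m<n⇒m<1+n (≤-reflexive (sym e))))
          | dec-true (suc (toℕ k) ≟ toℕ j) (sym e) = refl

  topple-far : ∀ k (c : Config n) j →
               toℕ j ≢ toℕ k → suc (toℕ j) ≢ toℕ k → suc (toℕ k) ≢ toℕ j →
               lookup (topple k c) j ≡ lookup c j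
  topple-far k c j j≢k sj≢k sk≢j
    rewrite lookup-topple k c j | dec-false (j Fin.≟ k) (j≢k ∘ cong toℕ)
          | dec-false (suc (toℕ j) ≟ toℕ k) sj≢k
          | dec-false (suc (toℕ k) ≟ toℕ j) sk≢j = refl

  topple-below : ∀ k (c : Config n) j → suc (toℕ j) < toℕ k → lookup (topple k c) j ≡ lookup c j
  topple-below k c j lt = topple-far k c j
    (<⇒≢ (<-trans (n<1+n _) lt)) (<⇒≢ lt) (>⇒≢ (<-trans (<-trans (n<1+n _) lt) (n<1+n _)))

  topple-above : ∀ k (c : Config n) j → suc (toℕ k) < toℕ j → lookup (topple k c) j ≡ lookup c j
  topple-above k c j lt = topple-far k c j
    (>⇒≢ (<-trans (n<1+n _) lt)) (>⇒≢ (<-trans (<-trans (n<1+n _) lt) (n<1+n _))) (<⇒≢ lt)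

  topple-≥ : ∀ k (c : Config n) j → j ≢ k → lookup c j ≤ lookup (topple k c) j
  topple-≥ k c j j≢k rewrite lookup-topple k c j | dec-false (j Fin.≟ k) j≢k with adjᵇ j k
  ... | true  = n≤1+n _
  ... | false = ≤-refl

  addGrain-self : ∀ k (c : Config n) → lookup (addGrain k c) k ≡ suc (lookup c k)
  addGrain-self k c = lookup∘updateAt k c

  addGrain-other : ∀ k (c : Config n) j → toℕ j ≢ toℕ k → lookup (addGrain k c) j ≡ lookup c j
  addGrain-other k c j j≢k = lookup∘updateAt′ j k (j≢k ∘ cong toℕ) c

  addGrain-≥ : ∀ k (c : Config n) → c ≤ᶜ addGrain k c
  addGrain-≥ k c = pointwise grow
    where
      grow : ∀ j → lookup c j ≤ lookup (addGrain k c) j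
      grow j with j Fin.≟ k
      ... | yes refl = ≤-trans (n≤1+n _) (≤-reflexive (sym (addGrain-self k c)))
      ... | no  j≢k  = ≤-reflexive (sym (addGrain-other k c j (j≢k ∘ toℕ-injective)))

  addGrain-below : ∀ {d t : Config n} k → d ≤ᶜ t → lookup d k < lookup t k → addGrain k d ≤ᶜ t
  addGrain-below {d} {t} k d≤t dk<tk = pointwise below
    where
      below : ∀ j → lookup (addGrain k d) j ≤ lookup t j
      below j with j Fin.≟ k
      ... | yes refl = ≤-trans (≤-reflexive (addGrain-self k d)) dk<tk
      ... | no  j≢k  =
        ≤-trans (≤-reflexive (addGrain-other k d j (j≢k ∘ toℕ-injective))) (lookup-≤ d≤t j)

  reach-above : {t : Config n} → Stable t → ∀ d → d ≤ᶜ t → Reach d t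
  reach-above {t} t-stable d = go d (<-wellFounded (deficit t d))
    where
      go : ∀ d → Acc _<_ (deficit t d) → d ≤ᶜ t → Reach d t
      go d (acc smaller) d≤t with any? (λ k → lookup d k <? lookup t k)
      ... | yes (k , dk<tk) =
        (k , ε , ≤ᶜ-stable d′≤t t-stable)
          ◅ go (addGrain k d) (smaller (deficit-addGrain t d k dk<tk)) d′≤t
        where
          d′≤t : addGrain k d ≤ᶜ t
          d′≤t = addGrain-below k d≤t dk<tk
      ... | no  none =
        subst (Reach d) (config-ext λ i → ≤-antisym (lookup-≤ d≤t i) (≮⇒≥ λ lt → none (i , lt))) ε

  reach-cmax : {d : Config n} → Stable d → Reach d cmax
  reach-cmax d-stable = reach-above cmax-stable _ (stable⇒≤ᶜcmax d-stable)

  reach-stable : Stable {n} Respects Reach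
  reach-stable = Star-respects step-stable
    where
      step-stable : Stable {n} Respects Step
      step-stable (_ , _ , d-stable) _ = d-stable

  -- 𝟙[ a < i ] + 𝟙[ i < b ] is the number of neighbours of i inside [a, b].
  Forbidden : Config n → ℕ → ℕ → Set
  Forbidden c a b = a ≤ b × b < n ×
    (∀ i → a ≤ toℕ i → toℕ i ≤ b → lookup c i < 𝟙[ a < toℕ i ] + 𝟙[ toℕ i < b ])

  Allowed : Config n → Set
  Allowed c = ∀ a b → ¬ Forbidden c a b

  allowed-mono : {c d : Config n} → c ≤ᶜ d → Allowed c → Allowed d
  allowed-mono c≤d c-allowed a b (a≤b , b<n , few) =
    c-allowed a b (a≤b , b<n , λ i a≤i i≤b → ≤-<-trans (lookup-≤ c≤d i) (few i a≤i i≤b))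

  forbidden-topple-outside : ∀ v y {a b} → (∀ i → a ≤ toℕ i → toℕ i ≤ b → i ≢ v) →
                             Forbidden (topple v y) a b → Forbidden y a b
  forbidden-topple-outside v y v∉ab (a≤b , b<n , few) =
    a≤b , b<n , λ i a≤i i≤b → ≤-<-trans (topple-≥ v y i (v∉ab i a≤i i≤b)) (few i a≤i i≤b)

  forbidden-topple-left : ∀ v y {a b} → a < toℕ v → toℕ v ≤ b →
                          Forbidden (topple v y) a b → Forbidden y a (pred (toℕ v))
  forbidden-topple-left v y {a} {b} a<v v≤b (_ , b<n , few) = <⇒≤pred a<v , <-trans w<b b<n , few′
    where
      open ≤-Reasoning
      w : ℕ
      w = pred (toℕ v)
      sw≡v : suc w ≡ toℕ v
      sw≡v = suc-pred-≢0 (m<n⇒n≢0 a<v)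
      w<b : w < b
      w<b = ≤-trans (≤-reflexive sw≡v) v≤b
      few′ : ∀ i → a ≤ toℕ i → toℕ i ≤ w → lookup y i < 𝟙[ a < toℕ i ] + 𝟙[ toℕ i < w ]
      few′ i a≤i i≤w with m≤n⇒m<n∨m≡n i≤w
      ... | inj₁ i<w = begin-strict
        lookup y i                       ≡⟨ topple-below v y i (≤-trans (s≤s i<w) (≤-reflexive sw≡v)) ⟨
        lookup (topple v y) i            <⟨ few i a≤i (<⇒≤ i<b) ⟩
        𝟙[ a < toℕ i ] + 𝟙[ toℕ i < b ] ≡⟨ cong (𝟙[ a < toℕ i ] +_) (𝟙-holds i<b) ⟩
        𝟙[ a < toℕ i ] + 1               ≡⟨ cong (𝟙[ a < toℕ i ] +_) (𝟙-holds i<w) ⟨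
        𝟙[ a < toℕ i ] + 𝟙[ toℕ i < w ] ∎
        where
          i<b : toℕ i < b
          i<b = <-trans i<w w<b
      ... | inj₂ i≡w = s<s⁻¹ (begin-strict
        suc (lookup y i)                       ≡⟨ topple-left v y i (trans (cong suc i≡w) sw≡v) ⟨
        lookup (topple v y) i                  <⟨ few i a≤i (<⇒≤ i<b) ⟩
        𝟙[ a < toℕ i ] + 𝟙[ toℕ i < b ]       ≡⟨ cong (𝟙[ a < toℕ i ] +_) (𝟙-holds i<b) ⟩
        𝟙[ a < toℕ i ] + 1                     ≡⟨ +-comm _ 1 ⟩
        suc 𝟙[ a < toℕ i ]                     ≡⟨ cong suc (+-identityʳ _) ⟨
        suc (𝟙[ a < toℕ i ] + 0)               ≡⟨ cong (λ m → suc (𝟙[ a < toℕ i ] + m)) i≮w ⟨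
        suc (𝟙[ a < toℕ i ] + 𝟙[ toℕ i < w ]) ∎)
        where
          i<b : toℕ i < b
          i<b = ≤-<-trans i≤w w<b
          i≮w : 𝟙[ toℕ i < w ] ≡ 0
          i≮w = 𝟙-fails (≤-reflexive (sym i≡w))

  forbidden-topple-right : ∀ v y {a b} → a ≡ toℕ v → toℕ v < b →
                           Forbidden (topple v y) a b → Forbidden y (suc (toℕ v)) b
  forbidden-topple-right v y {a} {b} a≡v v<b (_ , b<n , few) = v<b , b<n , few′
    where
      open ≤-Reasoning
      few′ : ∀ i → suc (toℕ v) ≤ toℕ i → toℕ i ≤ b →
             lookup y i < 𝟙[ suc (toℕ v) < toℕ i ] + 𝟙[ toℕ i < b ]
      few′ i v<i i≤b with m≤n⇒m<n∨m≡n v<i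
      ... | inj₁ sv<i = begin-strict
        lookup y i                                 ≡⟨ topple-above v y i sv<i ⟨
        lookup (topple v y) i                      <⟨ few i (<⇒≤ a<i) i≤b ⟩
        𝟙[ a < toℕ i ] + 𝟙[ toℕ i < b ]           ≡⟨ cong (_+ 𝟙[ toℕ i < b ]) (𝟙-holds a<i) ⟩
        1 + 𝟙[ toℕ i < b ]                         ≡⟨ cong (_+ 𝟙[ toℕ i < b ]) (𝟙-holds sv<i) ⟨
        𝟙[ suc (toℕ v) < toℕ i ] + 𝟙[ toℕ i < b ] ∎
        where
          a<i : a < toℕ i
          a<i = ≤-<-trans (≤-reflexive a≡v) v<i
      ... | inj₂ sv≡i = s<s⁻¹ (begin-strict
        suc (lookup y i)                                 ≡⟨ topple-right v y i (sym sv≡i) ⟨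
        lookup (topple v y) i                            <⟨ few i (<⇒≤ a<i) i≤b ⟩
        𝟙[ a < toℕ i ] + 𝟙[ toℕ i < b ]                 ≡⟨ cong (_+ 𝟙[ toℕ i < b ]) (𝟙-holds a<i) ⟩
        suc 𝟙[ toℕ i < b ]                               ≡⟨ cong (λ m → suc (m + 𝟙[ toℕ i < b ])) sv≮i ⟨
        suc (𝟙[ suc (toℕ v) < toℕ i ] + 𝟙[ toℕ i < b ]) ∎)
        where
          a<i : a < toℕ i
          a<i = ≤-<-trans (≤-reflexive a≡v) v<i
          sv≮i : 𝟙[ suc (toℕ v) < toℕ i ] ≡ 0
          sv≮i = 𝟙-fails (≤-reflexive (sym sv≡i))

  allowed-topple : Allowed Respects Topple
  allowed-topple {y} (v , _ , refl) y-allowed a b forbidden@(_ , _ , few)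
    with <-cmp a (toℕ v) | toℕ v ≤? b
  ... | tri> _ _ v<a | _       =
    y-allowed a b (forbidden-topple-outside v y (λ { i a≤i _ refl → <⇒≱ v<a a≤i }) forbidden)
  ... | _            | no  v≰b =
    y-allowed a b (forbidden-topple-outside v y (λ { i _ i≤b refl → v≰b i≤b }) forbidden)
  ... | tri< a<v _ _ | yes v≤b =
    y-allowed a (pred (toℕ v)) (forbidden-topple-left v y a<v v≤b forbidden)
  ... | tri≈ _ a≡v _ | yes v≤b with m≤n⇒m<n∨m≡n v≤b
  ...   | inj₁ v<b = y-allowed (suc (toℕ v)) b (forbidden-topple-right v y a≡v v<b forbidden)
  ...   | inj₂ v≡b = n≮0 (subst (lookup (topple v y) v <_)
                             (cong₂ _+_ (𝟙-fails (≤-reflexive (sym a≡v))) (𝟙-fails (≤-reflexive (sym v≡b))))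
                             (few v (≤-reflexive a≡v) v≤b))

  allowed-step : Allowed Respects Step
  allowed-step {c} (k , topplings , _) c-allowed =
    Star-respects {P = Allowed} (λ {x} → allowed-topple {x}) topplings
      (allowed-mono (addGrain-≥ k c) c-allowed)

  allowed-reach : Allowed Respects Reach
  allowed-reach = Star-respects {P = Allowed} allowed-step

  cmax-allowed : Allowed cmax
  cmax-allowed a b (a≤b , b<n , few) = <-irrefl refl (begin-strict
    pathDeg i                        ≡⟨ lookup∘tabulate pathDeg i ⟨
    lookup cmax i                    <⟨ few i (≤-reflexive (sym i≡a)) (≤-trans (≤-reflexive i≡a) a≤b) ⟩
    𝟙[ a < toℕ i ] + 𝟙[ toℕ i < b ] ≡⟨ cong (_+ 𝟙[ toℕ i < b ]) (𝟙-fails (≤-reflexive i≡a)) ⟩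
    𝟙[ toℕ i < b ]                   ≤⟨ 𝟙-mono b<n ⟩
    𝟙[ suc (toℕ i) < n ]             ≤⟨ m≤n+m _ _ ⟩
    pathDeg i                        ∎)
    where
      open ≤-Reasoning
      a<n : a < n
      a<n = ≤-<-trans a≤b b<n
      i : Fin n
      i = fromℕ< a<n
      i≡a : toℕ i ≡ a
      i≡a = toℕ-fromℕ< a<n

  allowed⇒zerosSeparated : {c : Config n} → Stable c → Allowed c → ZerosSeparated c
  allowed⇒zerosSeparated {c} c-stable c-allowed i j i<j ci≡0 cj≡0
    with any? (λ k → (toℕ i <? toℕ k ×-dec toℕ k <? toℕ j) ×-dec lookup c k ≟ 2)
  ... | yes (k , (i<k , k<j) , ck≡2) = k , i<k , k<j , ck≡2
  ... | no  no-two = ⊥-elim (c-allowed (toℕ i) (toℕ j) (<⇒≤ i<j , toℕ<n j , few))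
    where
      few : ∀ k → toℕ i ≤ toℕ k → toℕ k ≤ toℕ j →
            lookup c k < 𝟙[ toℕ i < toℕ k ] + 𝟙[ toℕ k < toℕ j ]
      few k i≤k k≤j with m≤n⇒m<n∨m≡n i≤k | m≤n⇒m<n∨m≡n k≤j
      ... | inj₂ i≡k | _ with toℕ-injective i≡k
      ...   | refl rewrite ci≡0 | 𝟙-holds i<j = m≤n+m 1 _
      few k i≤k k≤j | inj₁ i<k | inj₂ k≡j with toℕ-injective k≡j
      ...   | refl rewrite cj≡0 | 𝟙-holds i<k = s≤s z≤n
      few k i≤k k≤j | inj₁ i<k | inj₁ k<j rewrite 𝟙-holds i<k | 𝟙-holds k<j =
        ≤∧≢⇒< (stable⇒≤2 {c} c-stable k) (λ ck≡2 → no-two (k , (i<k , k<j) , ck≡2))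

data Region (p q j : ℕ) : Set where
  far-left        : suc j < p → Region p q j
  left-neighbour  : suc j ≡ p → Region p q j
  inside          : p ≤ j → j < q → Region p q j
  right-end       : j ≡ q → Region p q j
  right-neighbour : j ≡ suc q → Region p q j
  far-right       : suc q < j → Region p q j

region : ∀ p q j → Region p q j
region p q j with <-cmp (suc j) p
... | tri< sj<p _ _ = far-left sj<p
... | tri≈ _ sj≡p _ = left-neighbour sj≡p
... | tri> _ _ p<sj with <-cmp j q
...   | tri< j<q _ _ = inside (s≤s⁻¹ p<sj) j<q
...   | tri≈ _ j≡q _ = right-end j≡q
...   | tri> _ _ q<j with m≤n⇒m<n∨m≡n q<j
...     | inj₁ sq<j = far-right sq<j
...     | inj₂ sq≡j = right-neighbour (sym sq≡j)

module _ {n : ℕ} where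

  afterWave : Config n → ∀ {p q} (j : Fin n) → Region p q (toℕ j) → ℕ
  afterWave x j (far-left _)        = lookup x j
  afterWave x j (left-neighbour _)  = suc (lookup x j)
  afterWave x j (inside _ _)        = 1
  afterWave x j (right-end _)       = 0
  afterWave x j (right-neighbour _) = suc (lookup x j)
  afterWave x j (far-right _)       = lookup x j

  -- y is x after a grain is added at p and p, p + 1, …, q have toppled once each.
  WaveOf : Config n → ℕ → ℕ → Config n → Set
  WaveOf x p q y = ∀ j (r : Region p q (toℕ j)) → lookup y j ≡ afterWave x j r

  MaxOn : Config n → ℕ → ℕ → Set
  MaxOn x p q = ∀ j → p ≤ toℕ j → toℕ j ≤ q → lookup x j ≡ pathDeg j

  wave-start : ∀ k x → lookup x k ≡ pathDeg k →
               Unstable k (addGrain k x) × WaveOf x (toℕ k) (toℕ k) (topple k (addGrain k x))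
  wave-start k x xk≡max = ≤-reflexive (sym full) , shape
    where
      x⁺ : Config n
      x⁺ = addGrain k x
      full : lookup x⁺ k ≡ deg k
      full = trans (addGrain-self k x) (cong suc xk≡max)
      shape : WaveOf x (toℕ k) (toℕ k) (topple k x⁺)
      shape j (far-left sj<k) =
        trans (topple-below k x⁺ j sj<k) (addGrain-other k x j (<⇒≢ (<-trans (n<1+n _) sj<k)))
      shape j (left-neighbour sj≡k) =
        trans (topple-left k x⁺ j sj≡k) (cong suc (addGrain-other k x j (<⇒≢ (≤-reflexive sj≡k))))
      shape j (inside k≤j j<k) = ⊥-elim (<⇒≱ j<k k≤j)
      shape j (right-end j≡k) with toℕ-injective j≡k
      ... | refl = topple-full j x⁺ full
      shape j (right-neighbour j≡sk) =
        trans (topple-right k x⁺ j j≡sk)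
              (cong suc (addGrain-other k x j (>⇒≢ (≤-reflexive (sym j≡sk)))))
      shape j (far-right sk<j) =
        trans (topple-above k x⁺ j sk<j) (addGrain-other k x j (>⇒≢ (<-trans (n<1+n _) sk<j)))

  wave-extend : ∀ {x y p t} k → WaveOf x p t y → p ≤ t → toℕ k ≡ suc t → lookup x k ≡ pathDeg k →
                Unstable k y × WaveOf x p (suc t) (topple k y)
  wave-extend {x} {y} {p} {t} k y-wave p≤t k≡st xk≡max = ≤-reflexive (sym full) , shape
    where
      full : lookup y k ≡ deg k
      full = trans (y-wave k (right-neighbour k≡st)) (cong suc xk≡max)
      st≤k : suc t ≤ toℕ k
      st≤k = ≤-reflexive (sym k≡st)
      p<k : p < toℕ k
      p<k = ≤-trans (s≤s p≤t) st≤k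
      shape : WaveOf x p (suc t) (topple k y)
      shape j (far-left sj<p) =
        trans (topple-below k y j (<-trans sj<p p<k)) (y-wave j (far-left sj<p))
      shape j (left-neighbour sj≡p) =
        trans (topple-below k y j (≤-<-trans (≤-reflexive sj≡p) p<k)) (y-wave j (left-neighbour sj≡p))
      shape j (inside p≤j j<st) with m≤n⇒m<n∨m≡n (s≤s⁻¹ j<st)
      ... | inj₁ j<t =
        trans (topple-below k y j (≤-trans (s≤s j<t) st≤k)) (y-wave j (inside p≤j j<t))
      ... | inj₂ j≡t =
        trans (topple-left k y j (trans (cong suc j≡t) (sym k≡st))) (cong suc (y-wave j (right-end j≡t)))
      shape j (right-end j≡st) with toℕ-injective (trans j≡st (sym k≡st))
      ... | refl = topple-full j y full
      shape j (right-neighbour j≡sst) =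
        trans (topple-right k y j (trans j≡sst (cong suc (sym k≡st))))
              (cong suc (y-wave j (far-right (≤-reflexive (sym j≡sst)))))
      shape j (far-right sst<j) =
        trans (topple-above k y j (subst (λ m → suc m < toℕ j) (sym k≡st) sst<j))
              (y-wave j (far-right (<-trans (n<1+n _) sst<j)))

  wave : ∀ x {p} k q → toℕ k ≡ p → p ≤ q → q < n → MaxOn x p q →
         ∃ λ w → Star Topple (addGrain k x) w × WaveOf x p q w
  wave x k q refl k≤q q<n x-max with m≤n⇒m<n∨m≡n k≤q
  ... | inj₂ refl =
    let unstable , shape = wave-start k x (x-max k ≤-refl ≤-refl)
    in topple k (addGrain k x) , (k , unstable , refl) ◅ ε , shape
  wave x k (suc q) refl k≤sq sq<n x-max | inj₁ k<sq =
    let w , topplings , shape = wave x k q refl k≤q (<-trans (n<1+n q) sq<n) x-max-q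
        unstable , shape′ = wave-extend {x} {w} k′ shape k≤q k′≡sq x-max-k′
    in topple k′ w , topplings ◅◅ (k′ , unstable , refl) ◅ ε , shape′
    where
      k≤q : toℕ k ≤ q
      k≤q = s≤s⁻¹ k<sq
      k′ : Fin n
      k′ = fromℕ< sq<n
      k′≡sq : toℕ k′ ≡ suc q
      k′≡sq = toℕ-fromℕ< sq<n
      x-max-q : MaxOn x (toℕ k) q
      x-max-q j k≤j j≤q = x-max j k≤j (m≤n⇒m≤1+n j≤q)
      x-max-k′ : lookup x k′ ≡ pathDeg k′
      x-max-k′ = x-max k′ (≤-trans k≤sq (≤-reflexive (sym k′≡sq))) (≤-reflexive k′≡sq)

  cmax-reaches-positive : 0 < n → {c : Config n} → Stable c → (∀ j → lookup c j ≢ 0) → Reach cmax c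
  cmax-reaches-positive 0<n {c} c-stable c-positive =
    let w , topplings , shape = wave cmax k (pred n) (toℕ-fromℕ< 0<n) z≤n q<n cmax-max
        w≡𝟙 : ∀ j → lookup w j ≡ 𝟙[ suc (toℕ j) < n ]
        w≡𝟙 j = let r = region 0 (pred n) (toℕ j) in trans (shape j r) (ones-then-zero j r)
        w-stable : Stable w
        w-stable j = s≤s (≤-trans (≤-reflexive (w≡𝟙 j)) (m≤n+m _ _))
        w≤c : w ≤ᶜ c
        w≤c = pointwise λ j →
          ≤-trans (≤-reflexive (w≡𝟙 j)) (≤-trans (𝟙≤1 (suc (toℕ j)) n) (n≢0⇒n>0 (c-positive j)))
    in (k , topplings , w-stable) ◅ reach-above c-stable w w≤c
    where
      k : Fin n
      k = fromℕ< 0<n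
      sq≡n : suc (pred n) ≡ n
      sq≡n = suc-pred-≢0 (n>0⇒n≢0 0<n)
      q<n : pred n < n
      q<n = ≤-reflexive sq≡n
      cmax-max : MaxOn cmax 0 (pred n)
      cmax-max j _ _ = lookup∘tabulate pathDeg j
      ones-then-zero : ∀ j (r : Region 0 (pred n) (toℕ j)) → afterWave cmax j r ≡ 𝟙[ suc (toℕ j) < n ]
      ones-then-zero j (inside _ j<q)        = sym (𝟙-holds (≤-trans (s≤s j<q) q<n))
      ones-then-zero j (right-end j≡q)       = sym (𝟙-fails (≤-reflexive (trans (sym sq≡n) (cong suc (sym j≡q)))))
      ones-then-zero j (right-neighbour j≡n) = ⊥-elim (<⇒≢ (toℕ<n j) (trans j≡n sq≡n))
      ones-then-zero j (far-right n<j)       = ⊥-elim (<⇒≱ (toℕ<n j) (≤-trans (≤-reflexive (sym sq≡n)) (<⇒≤ n<j)))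

  beforeWave : Config n → ∀ {p q} (j : Fin n) → Region p q (toℕ j) → ℕ
  beforeWave c j (far-left _)        = lookup c j
  beforeWave c j (left-neighbour _)  = pred (lookup c j)
  beforeWave c j (inside _ _)        = pathDeg j
  beforeWave c j (right-end _)       = pathDeg j
  beforeWave c j (right-neighbour _) = pred (lookup c j)
  beforeWave c j (far-right _)       = lookup c j

  unwave : Config n → ℕ → ℕ → Config n
  unwave c p q = tabulate λ j → beforeWave c j (region p q (toℕ j))

  OnesBlock : Config n → ℕ → Fin n → Set
  OnesBlock c p q = p ≤ toℕ q × (∀ j → suc (toℕ j) ≡ p → lookup c j ≡ 2) ×
                    (∀ j → p ≤ toℕ j → toℕ j < toℕ q → lookup c j ≡ 1)

  maximal-onesBlock : ∀ {c} q → (∀ j → toℕ j < toℕ q → lookup c j ≡ 1 ⊎ lookup c j ≡ 2) →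
                      ∃ λ p → OnesBlock c p q
  maximal-onesBlock {c} q one-or-two = extend (toℕ q) ≤-refl (λ j q≤j j<q → ⊥-elim (<⇒≱ j<q q≤j))
    where
      extend : ∀ s → s ≤ toℕ q → (∀ j → s ≤ toℕ j → toℕ j < toℕ q → lookup c j ≡ 1) →
               ∃ λ p → OnesBlock c p q
      extend zero    _   ones = 0 , z≤n , (λ _ ()) , ones
      extend (suc s) s<q ones = step (one-or-two v v<q)
        where
          s<n : s < n
          s<n = <-trans s<q (toℕ<n q)
          v : Fin n
          v = fromℕ< s<n
          v≡s : toℕ v ≡ s
          v≡s = toℕ-fromℕ< s<n
          v<q : toℕ v < toℕ q
          v<q = ≤-trans (s≤s (≤-reflexive v≡s)) s<q
          step : lookup c v ≡ 1 ⊎ lookup c v ≡ 2 → ∃ λ p → OnesBlock c p q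
          step (inj₂ cv≡2) = suc s , s<q , two-left , ones
            where
              two-left : ∀ j → suc (toℕ j) ≡ suc s → lookup c j ≡ 2
              two-left j sj≡ss with toℕ-injective (trans (suc-injective sj≡ss) (sym v≡s))
              ... | refl = cv≡2
          step (inj₁ cv≡1) = extend s (<⇒≤ s<q) ones′
            where
              ones′ : ∀ j → s ≤ toℕ j → toℕ j < toℕ q → lookup c j ≡ 1
              ones′ j s≤j j<q with m≤n⇒m<n∨m≡n s≤j
              ... | inj₁ s<j = ones j s<j j<q
              ... | inj₂ s≡j with toℕ-injective (trans (sym s≡j) (sym v≡s))
              ...   | refl = cv≡1

  module Unwave (c : Config n) (p : ℕ) (q : Fin n) (p≤q : p ≤ toℕ q)
                (two-left : ∀ j → suc (toℕ j) ≡ p → lookup c j ≡ 2)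
                (ones : ∀ j → p ≤ toℕ j → toℕ j < toℕ q → lookup c j ≡ 1)
                (cq≡0 : lookup c q ≡ 0)
                (positive-right : ∀ j → toℕ j ≡ suc (toℕ q) → lookup c j ≢ 0) where

    x : Config n
    x = unwave c p (toℕ q)

    lookup-x : ∀ j → lookup x j ≡ beforeWave c j (region p (toℕ q) (toℕ j))
    lookup-x j = lookup∘tabulate _ j

    x-max : MaxOn x p (toℕ q)
    x-max j p≤j j≤q = trans (lookup-x j) (maximal (region p (toℕ q) (toℕ j)))
      where
        maximal : ∀ r → beforeWave c j r ≡ pathDeg j
        maximal (far-left sj<p)        = ⊥-elim (<⇒≱ (<-trans (n<1+n _) sj<p) p≤j)
        maximal (left-neighbour sj≡p)  = ⊥-elim (<⇒≱ (≤-reflexive sj≡p) p≤j)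
        maximal (inside _ _)           = refl
        maximal (right-end _)          = refl
        maximal (right-neighbour j≡sq) = ⊥-elim (<⇒≱ (≤-reflexive (sym j≡sq)) j≤q)
        maximal (far-right sq<j)       = ⊥-elim (<⇒≱ (<-trans (n<1+n _) sq<j) j≤q)

    x-stable : Stable c → Stable x
    x-stable c-stable j = ≤-<-trans (≤-reflexive (lookup-x j)) (bounded (region p (toℕ q) (toℕ j)))
      where
        bounded : ∀ r → beforeWave c j r < deg j
        bounded (far-left _)        = c-stable j
        bounded (left-neighbour _)  = ≤-<-trans pred[n]≤n (c-stable j)
        bounded (inside _ _)        = ≤-refl
        bounded (right-end _)       = ≤-refl
        bounded (right-neighbour _) = ≤-<-trans pred[n]≤n (c-stable j)
        bounded (far-right _)       = c-stable j

    wave-restores : ∀ j → afterWave x j (region p (toℕ q) (toℕ j)) ≡ lookup c j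
    wave-restores j = restores (region p (toℕ q) (toℕ j)) (lookup-x j)
      where
        restores : ∀ r → lookup x j ≡ beforeWave c j r → afterWave x j r ≡ lookup c j
        restores (far-left _)           xj = xj
        restores (left-neighbour sj≡p)  xj =
          trans (cong suc xj) (suc-pred-≢0 (λ cj≡0 → case trans (sym (two-left j sj≡p)) cj≡0 of λ ()))
        restores (inside p≤j j<q)       _  = sym (ones j p≤j j<q)
        restores (right-end j≡q)        _  = sym (trans (cong (lookup c) (toℕ-injective j≡q)) cq≡0)
        restores (right-neighbour j≡sq) xj = trans (cong suc xj) (suc-pred-≢0 (positive-right j j≡sq))
        restores (far-right _)          xj = xj

    x-step : Stable c → Step x c
    x-step c-stable =
      let w , topplings , shape = wave x k (toℕ q) (toℕ-fromℕ< p<n) p≤q (toℕ<n q) x-max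
          w≡c = config-ext λ j → trans (shape j (region p (toℕ q) (toℕ j))) (wave-restores j)
      in k , subst (Star Topple (addGrain k x)) w≡c topplings , c-stable
      where
        p<n : p < n
        p<n = ≤-<-trans p≤q (toℕ<n q)
        k : Fin n
        k = fromℕ< p<n

    x-zeros-right : 2 ≤ n → (∀ j → lookup c j ≡ 0 → toℕ q ≤ toℕ j) →
                    ∀ j → lookup x j ≡ 0 → suc (toℕ q) ≤ toℕ j
    x-zeros-right 2≤n leftmost j xj≡0 = right (region p (toℕ q) (toℕ j)) (trans (sym (lookup-x j)) xj≡0)
      where
        right : ∀ r → beforeWave c j r ≡ 0 → suc (toℕ q) ≤ toℕ j
        right (far-left sj<p) cj≡0 = ⊥-elim (<⇒≱ (<-≤-trans (<-trans (n<1+n _) sj<p) p≤q) (leftmost j cj≡0))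
        right (left-neighbour sj≡p) pred-cj≡0 =
          case trans (cong pred (sym (two-left j sj≡p))) pred-cj≡0 of λ ()
        right (inside _ _) deg≡0 = ⊥-elim (n>0⇒n≢0 (pathDeg-positive 2≤n j) deg≡0)
        right (right-end _) deg≡0 = ⊥-elim (n>0⇒n≢0 (pathDeg-positive 2≤n j) deg≡0)
        right (right-neighbour j≡sq) _ = ≤-reflexive (sym j≡sq)
        right (far-right sq<j) _ = <⇒≤ sq<j

    x-far-right : ∀ j → suc (toℕ q) < toℕ j → lookup x j ≡ lookup c j
    x-far-right j sq<j = trans (lookup-x j) (unchanged (region p (toℕ q) (toℕ j)))
      where
        q<j : toℕ q < toℕ j
        q<j = <-trans (n<1+n _) sq<j
        unchanged : ∀ r → beforeWave c j r ≡ lookup c j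
        unchanged (far-left sj<p)        = ⊥-elim (<-asym (<-trans (n<1+n _) (<-≤-trans sj<p p≤q)) q<j)
        unchanged (left-neighbour sj≡p)  = ⊥-elim (<-asym (<-≤-trans (≤-reflexive sj≡p) p≤q) q<j)
        unchanged (inside _ j<q)         = ⊥-elim (<-asym j<q q<j)
        unchanged (right-end j≡q)        = ⊥-elim (>⇒≢ q<j j≡q)
        unchanged (right-neighbour j≡sq) = ⊥-elim (>⇒≢ sq<j j≡sq)
        unchanged (far-right _)          = refl

    x-right-neighbour : ∀ j → toℕ j ≡ suc (toℕ q) → lookup x j ≡ pred (lookup c j)
    x-right-neighbour j j≡sq = trans (lookup-x j) (lowered (region p (toℕ q) (toℕ j)))
      where
        q<j : toℕ q < toℕ j
        q<j = ≤-reflexive (sym j≡sq)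
        lowered : ∀ r → beforeWave c j r ≡ pred (lookup c j)
        lowered (far-left sj<p)       = ⊥-elim (<-asym (<-trans (n<1+n _) (<-≤-trans sj<p p≤q)) q<j)
        lowered (left-neighbour sj≡p) = ⊥-elim (<-asym (<-≤-trans (≤-reflexive sj≡p) p≤q) q<j)
        lowered (inside _ j<q)        = ⊥-elim (<-asym j<q q<j)
        lowered (right-end j≡q)       = ⊥-elim (>⇒≢ q<j j≡q)
        lowered (right-neighbour _)   = refl
        lowered (far-right sq<j)      = ⊥-elim (>⇒≢ sq<j j≡sq)

    x-zero⇒c-zero : ∀ j → suc (toℕ q) < toℕ j → lookup x j ≡ 0 → lookup c j ≡ 0
    x-zero⇒c-zero j sq<j xj≡0 = trans (sym (x-far-right j sq<j)) xj≡0

    x-zerosSeparated : 2 ≤ n → (∀ j → lookup c j ≡ 0 → toℕ q ≤ toℕ j) → ZerosSeparated c →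
                       ZerosSeparated x
    x-zerosSeparated 2≤n leftmost c-zs i j i<j xi≡0 xj≡0
      with m≤n⇒m<n∨m≡n (x-zeros-right 2≤n leftmost i xi≡0)
    ... | inj₁ sq<i =
      let k , i<k , k<j , ck≡2 = c-zs i j i<j (x-zero⇒c-zero i sq<i xi≡0) (x-zero⇒c-zero j sq<j xj≡0)
      in k , i<k , k<j , trans (x-far-right k (<-trans sq<i i<k)) ck≡2
      where
        sq<j : suc (toℕ q) < toℕ j
        sq<j = <-trans sq<i i<j
    ... | inj₂ sq≡i =
      let k , q<k , k<j , ck≡2 = c-zs q j (<-trans (n<1+n _) sq<j) cq≡0 (x-zero⇒c-zero j sq<j xj≡0)
          sq<k = ≤∧≢⇒< q<k λ sq≡k → case trans (sym xi≡0) (xi≡1 sq≡k ck≡2) of λ ()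
      in k , subst (_< toℕ k) sq≡i sq<k , k<j , trans (x-far-right k sq<k) ck≡2
      where
        sq<j : suc (toℕ q) < toℕ j
        sq<j = subst (_< toℕ j) (sym sq≡i) i<j
        xi≡1 : ∀ {k} → suc (toℕ q) ≡ toℕ k → lookup c k ≡ 2 → lookup x i ≡ 1
        xi≡1 sq≡k ck≡2 with toℕ-injective (trans (sym sq≡i) sq≡k)
        ... | refl = trans (x-right-neighbour i (sym sq≡i)) (cong pred ck≡2)

  ZerosInLast : ℕ → Config n → Set
  ZerosInLast r c = ∀ j → lookup c j ≡ 0 → n ≤ r + toℕ j

  module _ (2≤n : 2 ≤ n) where

    cmax-reaches-zerosInLast : ∀ r {c} → Stable c → ZerosSeparated c → ZerosInLast r c → Reach cmax c
    cmax-reaches-zerosInLast zero c-stable _ no-zeros =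
      cmax-reaches-positive (≤-trans (s≤s z≤n) 2≤n) c-stable λ j cj≡0 → <⇒≱ (toℕ<n j) (no-zeros j cj≡0)
    cmax-reaches-zerosInLast (suc r) {c} c-stable c-zs zeros-in-last
      with any? (λ j → lookup c j ≟ 0 ×-dec r + toℕ j <? n)
    ... | no  none = cmax-reaches-zerosInLast r c-stable c-zs λ j cj≡0 → ≮⇒≥ λ lt → none (j , cj≡0 , lt)
    ... | yes (q , cq≡0 , r+q<n) =
      let p , p≤q , two-left , ones = maximal-onesBlock {c} q λ j j<q →
            one-or-two (stable⇒≤2 {c = c} c-stable j) (λ cj≡0 → <⇒≱ j<q (leftmost j cj≡0))
          open Unwave c p q p≤q two-left ones cq≡0 positive-right
          x-zeros-in-last : ZerosInLast r x
          x-zeros-in-last j xj≡0 = let open ≤-Reasoning in begin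
            n               ≤⟨ zeros-in-last q cq≡0 ⟩
            suc r + toℕ q   ≡⟨ +-suc r (toℕ q) ⟨
            r + suc (toℕ q) ≤⟨ +-monoʳ-≤ r (x-zeros-right 2≤n leftmost j xj≡0) ⟩
            r + toℕ j       ∎
      in cmax-reaches-zerosInLast r (x-stable c-stable) (x-zerosSeparated 2≤n leftmost c-zs) x-zeros-in-last
         ◅◅ (x-step c-stable ◅ ε)
      where
        leftmost : ∀ j → lookup c j ≡ 0 → toℕ q ≤ toℕ j
        leftmost j cj≡0 = +-cancelˡ-≤ r _ _ (s≤s⁻¹ (<-≤-trans r+q<n (zeros-in-last j cj≡0)))
        positive-right : ∀ j → toℕ j ≡ suc (toℕ q) → lookup c j ≢ 0
        positive-right j j≡sq cj≡0 =
          let k , q<k , k<j , _ = c-zs q j (≤-reflexive (sym j≡sq)) cq≡0 cj≡0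
          in <⇒≱ q<k (s≤s⁻¹ (subst (toℕ k <_) j≡sq k<j))

  cmax-reaches-zerosSeparated : {c : Config n} → Stable c → ZerosSeparated c → Reach cmax c
  cmax-reaches-zerosSeparated c-stable c-zs with 2 ≤? n
  ... | yes 2≤n = cmax-reaches-zerosInLast 2≤n n c-stable c-zs (λ j _ → m≤m+n n (toℕ j))
  ... | no  2≰n = subst (Reach cmax) (sym (stable⇒cmax (s≤s⁻¹ (≰⇒> 2≰n)) c-stable)) ε

theorem5p2 : (n : ℕ) → 1 ≤ n → (c : Vec ℕ n) → Stable c →
    (Recurrent c ⇔ ZerosSeparated c)
theorem5p2 n _ c c-stable = mk⇔ recurrent⇒zerosSeparated zerosSeparated⇒recurrent
  where
    recurrent⇒zerosSeparated : Recurrent c → ZerosSeparated c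
    recurrent⇒zerosSeparated (_ , returns) =
      allowed⇒zerosSeparated {c = c} c-stable
        (allowed-reach (returns cmax (reach-cmax {d = c} c-stable)) cmax-allowed)
    zerosSeparated⇒recurrent : ZerosSeparated c → Recurrent c
    zerosSeparated⇒recurrent c-zs =
      c-stable , λ d c↝d →
        reach-cmax (reach-stable c↝d c-stable) ◅◅ cmax-reaches-zerosSeparated c-stable c-zs
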